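{- Let $\mathcal{C}$ be the smallest class of graphs (up to isomorphism) such that (i) $K_1 \in \mathcal{C}$; (ii) if $G, H \in \mathcal{C}$, then their $0$-sum and every $1$-sum of $G$ and $H$ are in $\mathcal{C}$; and (iii) if $G, H \in \mathcal{C}$, then their $1$-join is in $\mathcal{C}$. Then $\mathcal{C}$ is exactly the class of $2$-cographs.
   Context: All graphs are finite and simple; $\overline{G}$ denotes the complement of $G$. A graph is $2$-connected if it has at least three vertices, is connected, and has no cut vertex. A graph $G$ is a $2$-cograph if $G$ has no induced subgraph $H$ such that both $H$ and $\overline{H}$ are $2$-connected. For graphs $G_1,G_2$ with disjoint vertex sets, the $0$-sum is their disjoint union, and a $1$-sum is a graph obtained from their disjoint union by identifying a vertex of $G_1$ with a vertex of $G_2$. For graphs $G$ and $H$ with $|V(G)\cap V(H)| \le 1$, the $1$-join $G \bigtriangledown_1 H$ is the graph with vertex set $V(G)\cup V(H)$ whose edges are those of $G$, those of $H$, and all edges joining a vertex of $V(G)-V(H)$ to a vertex of $V(H)-V(G)$. Equivalently, if $G,H$ are disjoint then $G \bigtriangledown_1 H=\overline{\overline{G}\oplus\overline{H}}$ (complement of the disjoint union of complements), and if they share exactly one vertex $v$ then $G \bigtriangledown_1 H$ is the complement of the $1$-sum of $\overline{G}$ and $\overline{H}$ obtained by identifying the copies of $v$. -}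

module Defs where

open import Data.Nat using (ℕ; zero; suc; _+_; _≤_)
open import Data.Fin using (Fin; zero; suc; splitAt; punchIn; _≟_)
open import Data.Bool using (Bool; true; false; not; _∧_; _∨_)
open import Data.Bool.Properties using (∧-zeroʳ)
open import Data.Maybe using (Maybe; just; nothing)
open import Data.Sum using (_⊎_; inj₁; inj₂)
open import Data.Product using (_×_; Σ)
open import Data.Empty using (⊥)
open import Relation.Nullary using (¬_; yes; no)
open import Relation.Nullary.Decidable using (⌊_⌋)
open import Relation.Binary.PropositionalEquality using (_≡_; refl; sym; cong; cong₂)
open import Function.Definitions using (Injective)

record Graph (n : ℕ) : Set where
  field
    Adj    : Fin n → Fin n → Bool
    symm   : ∀ i j → Adj i j ≡ Adj j i
    irrefl : ∀ i → Adj i i ≡ false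
open Graph public

record Iso {m n : ℕ} (G : Graph m) (H : Graph n) : Set where
  field
    to      : Fin m → Fin n
    from    : Fin n → Fin m
    from∘to : ∀ i → from (to i) ≡ i
    to∘from : ∀ j → to (from j) ≡ j
    adj     : ∀ i j → Adj H (to i) (to j) ≡ Adj G i j

eqb : ∀ {n} → Fin n → Fin n → Bool
eqb i j = ⌊ i ≟ j ⌋

eqb-sym : ∀ {n} (i j : Fin n) → eqb i j ≡ eqb j i
eqb-sym i j with i ≟ j | j ≟ i
... | yes _ | yes _ = refl
... | no _  | no _  = refl
... | yes p | no q  with q (sym p)
... | ()
eqb-sym i j | no p | yes q with p (sym q)
... | ()

eqb-refl : ∀ {n} (i : Fin n) → eqb i i ≡ true
eqb-refl i with i ≟ i
... | yes _ = refl
... | no p with p refl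
... | ()

compl : ∀ {n} → Graph n → Graph n
compl G = record
  { Adj    = λ i j → not (Adj G i j) ∧ not (eqb i j)
  ; symm   = λ i j → cong₂ (λ a b → not a ∧ not b) (symm G i j) (eqb-sym i j)
  ; irrefl = λ i → helper i
  }
  where
  helper : ∀ i → not (Adj G i i) ∧ not (eqb i i) ≡ false
  helper i rewrite eqb-refl i = ∧-zeroʳ _

induce : ∀ {k n} → Graph n → (Fin k → Fin n) → Graph k
induce G ι = record
  { Adj    = λ i j → Adj G (ι i) (ι j)
  ; symm   = λ i j → symm G (ι i) (ι j)
  ; irrefl = λ i → irrefl G (ι i)
  }

delete : ∀ {k} → Graph (suc k) → Fin (suc k) → Graph k
delete G v = induce G (punchIn v)

data Reach {n} (G : Graph n) : Fin n → Fin n → Set where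
  here : ∀ {i} → Reach G i i
  step : ∀ {i j k} → Adj G i j ≡ true → Reach G j k → Reach G i k

Connected : ∀ {n} → Graph n → Set
Connected {n} G = ∀ (i j : Fin n) → Reach G i j

-- 2-connected: at least three vertices, connected, and no cut vertex
-- (for a connected graph: deleting any vertex leaves a connected graph).
TwoConnected : ∀ {n} → Graph n → Set
TwoConnected {zero}  G = ⊥
TwoConnected {suc k} G = (3 ≤ suc k) × Connected G × (∀ v → Connected (delete G v))

TwoCograph : ∀ {n} → Graph n → Set
TwoCograph {n} G = ∀ (k : ℕ) (ι : Fin k → Fin n) → Injective _≡_ _≡_ ι →
  ¬ (TwoConnected (induce G ι) × TwoConnected (compl (induce G ι)))

-- Gluing two graphs G, H into a graph on Fin N, where each new vertex
-- corresponds to (at most) one vertex of G and (at most) one of H.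
-- Edges: those of G plus those of H.
liftAdj : ∀ {m} → Graph m → Maybe (Fin m) → Maybe (Fin m) → Bool
liftAdj G (just a) (just b) = Adj G a b
liftAdj G _        _        = false

liftAdj-sym : ∀ {m} (G : Graph m) x y → liftAdj G x y ≡ liftAdj G y x
liftAdj-sym G (just a) (just b) = symm G a b
liftAdj-sym G (just a) nothing  = refl
liftAdj-sym G nothing  (just b) = refl
liftAdj-sym G nothing  nothing  = refl

liftAdj-irr : ∀ {m} (G : Graph m) x → liftAdj G x x ≡ false
liftAdj-irr G (just a) = irrefl G a
liftAdj-irr G nothing  = refl

glue : ∀ {m n N} → Graph m → Graph n →
       (Fin N → Maybe (Fin m)) → (Fin N → Maybe (Fin n)) → Graph N
glue G H gs hs = record
  { Adj    = λ i j → liftAdj G (gs i) (gs j) ∨ liftAdj H (hs i) (hs j)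
  ; symm   = λ i j → cong₂ _∨_ (liftAdj-sym G (gs i) (gs j)) (liftAdj-sym H (hs i) (hs j))
  ; irrefl = λ i → cong₂ _∨_ (liftAdj-irr G (gs i)) (liftAdj-irr H (hs i))
  }

sum0 : ∀ {m n} → Graph m → Graph n → Graph (m + n)
sum0 {m} {n} G H = glue G H gs hs
  where
  gs : Fin (m + n) → Maybe (Fin m)
  gs w with splitAt m w
  ... | inj₁ a = just a
  ... | inj₂ _ = nothing
  hs : Fin (m + n) → Maybe (Fin n)
  hs w with splitAt m w
  ... | inj₁ _ = nothing
  ... | inj₂ b = just b

-- Vertex set Fin (1 + (m + n)): vertex zero is the identified vertex,
-- followed by the other vertices of G, then the other vertices of H.
sum1 : ∀ {m n} → Graph (suc m) → Graph (suc n) → Fin (suc m) → Fin (suc n) →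
       Graph (suc (m + n))
sum1 {m} {n} G H u v = glue G H gs hs
  where
  gs : Fin (suc (m + n)) → Maybe (Fin (suc m))
  gs zero = just u
  gs (suc w) with splitAt m w
  ... | inj₁ a = just (punchIn u a)
  ... | inj₂ _ = nothing
  hs : Fin (suc (m + n)) → Maybe (Fin (suc n))
  hs zero = just v
  hs (suc w) with splitAt m w
  ... | inj₁ _ = nothing
  ... | inj₂ b = just (punchIn v b)

-- 1-joins, via the complement characterisation given in the paper.
join0 : ∀ {m n} → Graph m → Graph n → Graph (m + n)
join0 G H = compl (sum0 (compl G) (compl H))

join1 : ∀ {m n} → Graph (suc m) → Graph (suc n) → Fin (suc m) → Fin (suc n) →
        Graph (suc (m + n))
join1 G H u v = compl (sum1 (compl G) (compl H) u v)

K1 : Graph 1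
K1 = record { Adj = λ _ _ → false ; symm = λ _ _ → refl ; irrefl = λ _ → refl }

data InC : ∀ {n} → Graph n → Set where
  k1    : InC K1
  iso   : ∀ {m n} {G : Graph m} {H : Graph n} → InC G → Iso G H → InC H
  s0    : ∀ {m n} {G : Graph m} {H : Graph n} → InC G → InC H → InC (sum0 G H)
  s1    : ∀ {m n} {G : Graph (suc m)} {H : Graph (suc n)} → InC G → InC H →
          (u : Fin (suc m)) (v : Fin (suc n)) → InC (sum1 G H u v)
  j0    : ∀ {m n} {G : Graph m} {H : Graph n} → InC G → InC H → InC (join0 G H)
  j1    : ∀ {m n} {G : Graph (suc m)} {H : Graph (suc n)} → InC G → InC H →
          (u : Fin (suc m)) (v : Fin (suc n)) → InC (join1 G H u v)

-- A connected induced subgraph of a 0-sum lies inside one summand, and a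
-- 2-connected induced subgraph of a 1-sum lies inside one summand together with
-- the identified vertex (removing that vertex leaves it connected). So 0- and
-- 1-sums of 2-cographs are 2-cographs; as 2-cographs are closed under
-- complementation and a 1-join is the complement of a sum of complements, so are
-- 1-joins.
--
-- Conversely, if G is a 2-cograph on at least two vertices, then G or its
-- complement is disconnected or has a cut vertex (on two vertices one of them is
-- disconnected). Splitting off the vertices reachable from a fixed vertex, in G or
-- in G minus the cut vertex, writes G (or its complement) as a 0-sum or 1-sum of
-- two smaller induced subgraphs, which are again 2-cographs; so G is a 0-sum,
-- 1-sum or 1-join of members of 𝒞 by induction on the number of vertices.

module Submission where

open import Defs
open import Data.Nat using (ℕ; zero; suc; _+_; _≤_; _<_; s≤s; z≤n; >-nonZero⁻¹)
open import Data.Nat.Properties using (≤-trans; m≤m+n; m<m+n; m<n+m)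
open import Data.Nat.Induction using (<-rec)
open import Data.Fin using (Fin; zero; suc; splitAt; join; punchIn; punchOut; _↑ˡ_; _↑ʳ_; _≟_)
open import Data.Fin.Properties
  using (punchIn-injective; punchInᵢ≢i; punchOut-cong; punchIn-punchOut; punchOut-punchIn;
         splitAt-↑ˡ; splitAt-↑ʳ; splitAt-join; join-splitAt; any?; all?; ¬∀⟶∃¬; injective⇒≤;
         nonZeroIndex)
open import Data.Fin.Permutation using (↔⇒≡)
open import Data.Bool using (Bool; true; false; not; _∧_)
open import Data.Bool.Properties using (∧-zeroʳ; ∨-identityʳ)
import Data.Bool.Properties as Bool
open import Data.Sum using (_⊎_; inj₁; inj₂)
open import Data.Sum.Properties using (inj₁-injective; inj₂-injective)
import Data.Sum as Sum
open import Data.Product using (_×_; _,_; proj₁; proj₂; ∃; ∃₂)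
open import Data.Empty using (⊥-elim)
open import Function using (_∘_; id)
open import Function.Bundles using (mk↔ₛ′)
open import Function.Definitions using (Injective)
open import Relation.Nullary using (¬_; yes; no; Dec)
open import Relation.Unary using (Decidable)
open import Relation.Nullary.Decidable using (_×-dec_)
open import Relation.Binary.PropositionalEquality
  using (_≡_; _≢_; refl; sym; trans; cong; cong₂; subst)

Obstruction : ∀ {n} → Graph n → Set
Obstruction H = TwoConnected H × TwoConnected (compl H)

infix 4 _≈_

record _≈_ {n} (G H : Graph n) : Set where
  constructor mk≈
  field adj-≡ : ∀ i j → Adj G i j ≡ Adj H i j
open _≈_

≈-refl : ∀ {n} {G : Graph n} → G ≈ G
≈-refl = mk≈ λ _ _ → refl

≈-sym : ∀ {n} {G H : Graph n} → G ≈ H → H ≈ G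
≈-sym e = mk≈ λ i j → sym (adj-≡ e i j)

≈-trans : ∀ {n} {G H K : Graph n} → G ≈ H → H ≈ K → G ≈ K
≈-trans e f = mk≈ λ i j → trans (adj-≡ e i j) (adj-≡ f i j)

Reach-resp-≈ : ∀ {n} {G H : Graph n} → G ≈ H → ∀ {i j} → Reach G i j → Reach H i j
Reach-resp-≈ e here       = here
Reach-resp-≈ e (step a w) = step (trans (sym (adj-≡ e _ _)) a) (Reach-resp-≈ e w)

Connected-resp-≈ : ∀ {n} {G H : Graph n} → G ≈ H → Connected G → Connected H
Connected-resp-≈ e c i j = Reach-resp-≈ e (c i j)

induce-resp-≈ : ∀ {k n} {G H : Graph n} → G ≈ H → (ι : Fin k → Fin n) → induce G ι ≈ induce H ι
induce-resp-≈ e ι = mk≈ λ i j → adj-≡ e (ι i) (ι j)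

compl-resp-≈ : ∀ {n} {G H : Graph n} → G ≈ H → compl G ≈ compl H
compl-resp-≈ e = mk≈ λ i j → cong (λ a → not a ∧ not (eqb i j)) (adj-≡ e i j)

TwoConnected-resp-≈ : ∀ {n} {G H : Graph n} → G ≈ H → TwoConnected G → TwoConnected H
TwoConnected-resp-≈ {zero}  e ()
TwoConnected-resp-≈ {suc k} e (3≤n , c , d) =
  3≤n , Connected-resp-≈ e c , λ v → Connected-resp-≈ (induce-resp-≈ e (punchIn v)) (d v)

Obstruction-resp-≈ : ∀ {n} {G H : Graph n} → G ≈ H → Obstruction G → Obstruction H
Obstruction-resp-≈ e (p , q) = TwoConnected-resp-≈ e p , TwoConnected-resp-≈ (compl-resp-≈ e) q

eqb-true : ∀ {n} {i j : Fin n} → eqb i j ≡ true → i ≡ j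
eqb-true {i = i} {j} e with i ≟ j
... | yes i≡j = i≡j

eqb-false : ∀ {n} {i j : Fin n} → i ≢ j → eqb i j ≡ false
eqb-false {i = i} {j} i≢j with i ≟ j
... | yes i≡j = ⊥-elim (i≢j i≡j)
... | no _    = refl

eqb-injective : ∀ {k n} {ι : Fin k → Fin n} → Injective _≡_ _≡_ ι →
                ∀ i j → eqb (ι i) (ι j) ≡ eqb i j
eqb-injective {ι = ι} inj i j with i ≟ j
... | yes refl = eqb-refl (ι i)
... | no i≢j   = eqb-false (i≢j ∘ inj)

compl-involutive : ∀ {n} (G : Graph n) → compl (compl G) ≈ G
compl-involutive G = mk≈ adj
  where
  adj : ∀ i j → Adj (compl (compl G)) i j ≡ Adj G i j
  adj i j with eqb i j in e
  ... | true rewrite eqb-true {i = i} {j} e = trans (∧-zeroʳ _) (sym (irrefl G j))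
  ... | false with Adj G i j
  ...   | true  = refl
  ...   | false = refl

compl-induce : ∀ {k n} (G : Graph n) {ι : Fin k → Fin n} → Injective _≡_ _≡_ ι →
               compl (induce G ι) ≈ induce (compl G) ι
compl-induce G {ι} inj =
  mk≈ λ i j → cong (λ b → not (Adj G (ι i) (ι j)) ∧ not b) (sym (eqb-injective inj i j))

Obstruction-compl : ∀ {n} {H : Graph n} → Obstruction H → Obstruction (compl H)
Obstruction-compl {H = H} (p , q) = q , TwoConnected-resp-≈ (≈-sym (compl-involutive H)) p

Iso-compl : ∀ {m n} {G : Graph m} {H : Graph n} → Iso G H → Iso (compl G) (compl H)
Iso-compl I = record
  { to = to ; from = from ; from∘to = from∘to ; to∘from = to∘from
  ; adj = λ i j → cong₂ (λ a b → not a ∧ not b) (adj i j) (eqb-injective to-injective i j) }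
  where
  open Iso I
  to-injective : Injective _≡_ _≡_ to
  to-injective {x} {y} e = trans (sym (from∘to x)) (trans (cong from e) (from∘to y))

Iso-resp-≈ : ∀ {m n} {G : Graph m} {H H′ : Graph n} → Iso G H → H ≈ H′ → Iso G H′
Iso-resp-≈ I e = record
  { to = to ; from = from ; from∘to = from∘to ; to∘from = to∘from
  ; adj = λ i j → trans (sym (adj-≡ e _ _)) (adj i j) }
  where open Iso I

Iso-transpose-compl : ∀ {m n} {G : Graph m} {H : Graph n} → Iso G (compl H) → Iso (compl G) H
Iso-transpose-compl {H = H} I = Iso-resp-≈ (Iso-compl I) (compl-involutive H)

Iso⇒≡ : ∀ {m n} {G : Graph m} {H : Graph n} → Iso G H → m ≡ n
Iso⇒≡ I = ↔⇒≡ (mk↔ₛ′ to from to∘from from∘to)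
  where open Iso I

-- Closure properties of 2-cographs

record AdjMap {m n} (G : Graph m) (S : Graph n) : Set where
  field
    map       : Fin m → Fin n
    preserves : ∀ a b → Adj S (map a) (map b) ≡ Adj G a b
open AdjMap

¬Obstruction-within : ∀ {k m n} {G : Graph m} {S : Graph n} (f : AdjMap G S) → TwoCograph G →
  (ι : Fin k → Fin n) → Injective _≡_ _≡_ ι → (∀ x → ∃ λ a → ι x ≡ map f a) →
  ¬ Obstruction (induce S ι)
¬Obstruction-within {k} {G = G} {S} f tc ι inj preimage =
  tc k κ κ-injective ∘ Obstruction-resp-≈ same
  where
  κ : Fin k → _
  κ x = proj₁ (preimage x)
  ι≡f∘κ : ∀ x → ι x ≡ map f (κ x)
  ι≡f∘κ x = proj₂ (preimage x)
  κ-injective : Injective _≡_ _≡_ κ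
  κ-injective {x} {y} e = inj (trans (ι≡f∘κ x) (trans (cong (map f) e) (sym (ι≡f∘κ y))))
  same : induce S ι ≈ induce G κ
  same = mk≈ λ i j → trans (cong₂ (Adj S) (ι≡f∘κ i) (ι≡f∘κ j)) (preserves f (κ i) (κ j))

Iso⇒AdjMap : ∀ {m n} {G : Graph m} {H : Graph n} → Iso G H → AdjMap G H
Iso⇒AdjMap I = record { map = Iso.to I ; preserves = Iso.adj I }

TwoCograph-iso : ∀ {m n} {G : Graph m} {H : Graph n} → Iso G H → TwoCograph G → TwoCograph H
TwoCograph-iso I tc k ι inj =
  ¬Obstruction-within (Iso⇒AdjMap I) tc ι inj λ x → from (ι x) , sym (to∘from (ι x))
  where open Iso I

TwoCograph-induce : ∀ {k n} (G : Graph n) {ι : Fin k → Fin n} → Injective _≡_ _≡_ ι →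
                    TwoCograph G → TwoCograph (induce G ι)
TwoCograph-induce G inj tc k κ κ-injective = tc k _ (κ-injective ∘ inj)

TwoCograph-compl : ∀ {n} {G : Graph n} → TwoCograph G → TwoCograph (compl G)
TwoCograph-compl {G = G} tc k ι inj = tc k ι inj ∘ Obstruction-resp-≈ same ∘ Obstruction-compl
  where
  same : compl (induce (compl G) ι) ≈ induce G ι
  same = ≈-trans (compl-resp-≈ (≈-sym (compl-induce G inj))) (compl-involutive (induce G ι))

TwoConnected⇒3≤ : ∀ {n} {H : Graph n} → TwoConnected H → 3 ≤ n
TwoConnected⇒3≤ {suc _} (3≤n , _) = 3≤n

TwoCograph-small : ∀ {n} (G : Graph n) → n ≤ 2 → TwoCograph G
TwoCograph-small G n≤2 k ι inj (p , _)
  with ≤-trans (TwoConnected⇒3≤ p) (≤-trans (injective⇒≤ inj) n≤2)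
... | s≤s (s≤s ())

Reach-preserves : ∀ {n} {A : Set} {G : Graph n} (c : Fin n → A) →
  (∀ {x y} → Adj G x y ≡ true → c x ≡ c y) → ∀ {x y} → Reach G x y → c x ≡ c y
Reach-preserves c edge here       = refl
Reach-preserves c edge (step a w) = trans (edge a) (Reach-preserves c edge w)

Reach-induce : ∀ {k n} {G : Graph n} (ι : Fin k → Fin n) {a b} →
               Reach (induce G ι) a b → Reach G (ι a) (ι b)
Reach-induce ι here       = here
Reach-induce ι (step e w) = step e (Reach-induce ι w)

Reach-snoc : ∀ {n} {G : Graph n} {a b c} → Reach G a b → Adj G b c ≡ true → Reach G a c
Reach-snoc here        e = step e here
Reach-snoc (step e′ w) e = step e′ (Reach-snoc w e)

TwoConnected-constant-off : ∀ {n} {A : Set} {H : Graph n} → TwoConnected H →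
  (c : Fin n → A) (z : Fin n) → (∀ {x y} → z ≢ x → z ≢ y → Adj H x y ≡ true → c x ≡ c y) →
  ∀ {x y} → z ≢ x → z ≢ y → c x ≡ c y
TwoConnected-constant-off {suc _} {H = H} (_ , _ , connected-off) c z edge {x} {y} z≢x z≢y =
  trans (cong c (sym (punchIn-punchOut z≢x)))
        (trans (Reach-preserves (c ∘ punchIn z) edge-off (connected-off z _ _))
               (cong c (punchIn-punchOut z≢y)))
  where
  edge-off : ∀ {a b} → Adj (delete H z) a b ≡ true → c (punchIn z a) ≡ c (punchIn z b)
  edge-off {a} {b} = edge (punchInᵢ≢i z a ∘ sym) (punchInᵢ≢i z b ∘ sym)

Reach-last-visit : ∀ {k} (G : Graph (suc k)) (i : Fin (suc k)) (j : Fin k) {a} →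
  Reach G a (punchIn i j) →
  (∃ λ l → Adj G i (punchIn i l) ≡ true × Reach (delete G i) l j) ⊎
  (∃ λ a′ → punchIn i a′ ≡ a × Reach (delete G i) a′ j)
Reach-last-visit G i j here = inj₂ (j , refl , here)
Reach-last-visit G i j (step {i = a} e w) with Reach-last-visit G i j w
... | inj₁ via-neighbour = inj₁ via-neighbour
... | inj₂ (b′ , refl , w′) with a ≟ i
...   | yes refl = inj₁ (b′ , e , w′)
...   | no a≢i   = inj₂ (punchOut i≢a , punchIn-punchOut i≢a , step e′ w′)
  where
  i≢a : i ≢ a
  i≢a = a≢i ∘ sym
  e′ : Adj G (punchIn i (punchOut i≢a)) (punchIn i b′) ≡ true
  e′ = trans (cong (λ t → Adj G t (punchIn i b′)) (punchIn-punchOut i≢a)) e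

-- For i ≢ j, j is reachable from i iff some neighbour of i reaches j in G − i,
-- a graph with fewer vertices.
Reach? : ∀ {n} (G : Graph n) (i j : Fin n) → Dec (Reach G i j)
Reach? {suc _} G i j with i ≟ j
... | yes refl = yes here
... | no i≢j
  with any? (λ l → (Adj G i (punchIn i l) Bool.≟ true) ×-dec Reach? (delete G i) l (punchOut i≢j))
...   | yes (l , e , w) =
  yes (step e (subst (Reach G _) (punchIn-punchOut i≢j) (Reach-induce (punchIn i) w)))
...   | no ∄neighbour = no λ w →
  Sum.[ ∄neighbour , (λ (a′ , i≡a′ , _) → punchInᵢ≢i i a′ i≡a′) ]′
    (Reach-last-visit G i (punchOut i≢j) (subst (Reach G i) (sym (punchIn-punchOut i≢j)) w))

Connected? : ∀ {n} (G : Graph n) → Dec (Connected G)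
Connected? G = all? λ i → all? (Reach? G i)

¬Connected⇒unreachable : ∀ {n} (G : Graph n) → ¬ Connected G → ∃₂ λ i j → ¬ Reach G i j
¬Connected⇒unreachable {n} G ¬connected
  with ¬∀⟶∃¬ n _ (λ i → all? (Reach? G i)) ¬connected
... | i , ¬∀j with ¬∀⟶∃¬ n _ (Reach? G i) ¬∀j
...   | j , ¬i⇝j = i , j , ¬i⇝j

Separates : ∀ {N} → Graph N → (Fin N → Set) → Set
Separates X P = ∀ {k l} → P k → ¬ P l → Adj X k l ≡ false

Reach-separates : ∀ {N} (X : Graph N) (i : Fin N) → Separates X (Reach X i)
Reach-separates X i i⇝k ¬i⇝l = Bool.¬-not λ e → ¬i⇝l (Reach-snoc i⇝k e)

-- 0-sums and 1-sums

data Sum0View {m n : ℕ} : Fin (m + n) → Set where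
  left  : (a : Fin m) → Sum0View (a ↑ˡ n)
  right : (b : Fin n) → Sum0View (m ↑ʳ b)

sum0-view : ∀ m n (w : Fin (m + n)) → Sum0View {m} {n} w
sum0-view m n w = subst Sum0View (join-splitAt m n w) (view (splitAt m w))
  where
  view : (s : Fin m ⊎ Fin n) → Sum0View (join m n s)
  view (inj₁ a) = left a
  view (inj₂ b) = right b

data Sum1View {m n : ℕ} : Fin (suc (m + n)) → Set where
  shared : Sum1View zero
  left   : (a : Fin m) → Sum1View (suc (a ↑ˡ n))
  right  : (b : Fin n) → Sum1View (suc (m ↑ʳ b))

sum1-view : ∀ m n (w : Fin (suc (m + n))) → Sum1View {m} {n} w
sum1-view m n zero = shared
sum1-view m n (suc w) with sum0-view m n w
... | left a  = left a
... | right b = right b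

module Sum0 {m n} (G : Graph m) (H : Graph n) where

  adj-left-left : ∀ a b → Adj (sum0 G H) (a ↑ˡ n) (b ↑ˡ n) ≡ Adj G a b
  adj-left-left a b rewrite splitAt-↑ˡ m a n | splitAt-↑ˡ m b n = ∨-identityʳ _

  adj-left-right : ∀ a b → Adj (sum0 G H) (a ↑ˡ n) (m ↑ʳ b) ≡ false
  adj-left-right a b rewrite splitAt-↑ˡ m a n | splitAt-↑ʳ m n b = refl

  adj-right-left : ∀ a b → Adj (sum0 G H) (m ↑ʳ a) (b ↑ˡ n) ≡ false
  adj-right-left a b rewrite splitAt-↑ʳ m n a | splitAt-↑ˡ m b n = refl

  adj-right-right : ∀ a b → Adj (sum0 G H) (m ↑ʳ a) (m ↑ʳ b) ≡ Adj H a b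
  adj-right-right a b rewrite splitAt-↑ʳ m n a | splitAt-↑ʳ m n b = refl

  isLeft : Fin (m + n) → Bool
  isLeft w with sum0-view m n w
  ... | left _  = true
  ... | right _ = false

  isLeft-edge : ∀ {x y} → Adj (sum0 G H) x y ≡ true → isLeft x ≡ isLeft y
  isLeft-edge {x} {y} e with sum0-view m n x | sum0-view m n y
  ... | left a  | left b  = refl
  ... | right a | right b = refl
  ... | left a  | right b with () ← trans (sym (adj-left-right a b)) e
  ... | right a | left b  with () ← trans (sym (adj-right-left a b)) e

  left-map : AdjMap G (sum0 G H)
  left-map = record { map = _↑ˡ n ; preserves = adj-left-left }

  right-map : AdjMap H (sum0 G H)
  right-map = record { map = m ↑ʳ_ ; preserves = adj-right-right }

  left-preimage : ∀ w → isLeft w ≡ true → ∃ λ a → w ≡ a ↑ˡ n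
  left-preimage w p with sum0-view m n w
  ... | left a = a , refl

  right-preimage : ∀ w → isLeft w ≡ false → ∃ λ b → w ≡ m ↑ʳ b
  right-preimage w p with sum0-view m n w
  ... | right b = b , refl

  Connected-one-sided : ∀ {k} {ι : Fin k → Fin (m + n)} → Connected (induce (sum0 G H) ι) →
                        ∀ x y → isLeft (ι x) ≡ isLeft (ι y)
  Connected-one-sided {ι = ι} connected x y = Reach-preserves (isLeft ∘ ι) isLeft-edge (connected x y)

  TwoCograph-sum0 : TwoCograph G → TwoCograph H → TwoCograph (sum0 G H)
  TwoCograph-sum0 tG tH (suc k) ι inj obs@((_ , connected , _) , _) with isLeft (ι zero) in e
  ... | true  = ¬Obstruction-within left-map tG ι inj
                  (λ x → left-preimage (ι x) (trans (Connected-one-sided connected x zero) e)) obs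
  ... | false = ¬Obstruction-within right-map tH ι inj
                  (λ x → right-preimage (ι x) (trans (Connected-one-sided connected x zero) e)) obs

module Sum1 {m n} (G : Graph (suc m)) (H : Graph (suc n)) (u : Fin (suc m)) (v : Fin (suc n)) where

  S : Graph (suc (m + n))
  S = sum1 G H u v

  adj-shared-left : ∀ a → Adj S zero (suc (a ↑ˡ n)) ≡ Adj G u (punchIn u a)
  adj-shared-left a rewrite splitAt-↑ˡ m a n = ∨-identityʳ _

  adj-left-shared : ∀ a → Adj S (suc (a ↑ˡ n)) zero ≡ Adj G (punchIn u a) u
  adj-left-shared a rewrite splitAt-↑ˡ m a n = ∨-identityʳ _

  adj-left-left : ∀ a b → Adj S (suc (a ↑ˡ n)) (suc (b ↑ˡ n)) ≡ Adj G (punchIn u a) (punchIn u b)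
  adj-left-left a b rewrite splitAt-↑ˡ m a n | splitAt-↑ˡ m b n = ∨-identityʳ _

  adj-shared-right : ∀ b → Adj S zero (suc (m ↑ʳ b)) ≡ Adj H v (punchIn v b)
  adj-shared-right b rewrite splitAt-↑ʳ m n b = refl

  adj-right-shared : ∀ b → Adj S (suc (m ↑ʳ b)) zero ≡ Adj H (punchIn v b) v
  adj-right-shared b rewrite splitAt-↑ʳ m n b = refl

  adj-right-right : ∀ a b → Adj S (suc (m ↑ʳ a)) (suc (m ↑ʳ b)) ≡ Adj H (punchIn v a) (punchIn v b)
  adj-right-right a b rewrite splitAt-↑ʳ m n a | splitAt-↑ʳ m n b = refl

  adj-left-right : ∀ a b → Adj S (suc (a ↑ˡ n)) (suc (m ↑ʳ b)) ≡ false
  adj-left-right a b rewrite splitAt-↑ˡ m a n | splitAt-↑ʳ m n b = refl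

  adj-right-left : ∀ a b → Adj S (suc (m ↑ʳ a)) (suc (b ↑ˡ n)) ≡ false
  adj-right-left a b rewrite splitAt-↑ʳ m n a | splitAt-↑ˡ m b n = refl

  isLeft : Fin (suc (m + n)) → Bool
  isLeft w with sum1-view m n w
  ... | shared  = false
  ... | left _  = true
  ... | right _ = false

  isRight : Fin (suc (m + n)) → Bool
  isRight w with sum1-view m n w
  ... | shared  = false
  ... | left _  = false
  ... | right _ = true

  isRight⇒¬isLeft : ∀ w → isRight w ≡ true → isLeft w ≡ false
  isRight⇒¬isLeft w p with sum1-view m n w
  ... | right _ = refl

  isLeft⇒≢shared : ∀ w → isLeft w ≡ true → w ≢ zero
  isLeft⇒≢shared w p refl with () ← p

  isRight⇒≢shared : ∀ w → isRight w ≡ true → w ≢ zero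
  isRight⇒≢shared w p refl with () ← p

  isLeft-edge : ∀ {x y} → x ≢ zero → y ≢ zero → Adj S x y ≡ true → isLeft x ≡ isLeft y
  isLeft-edge {x} {y} x≢0 y≢0 e with sum1-view m n x | sum1-view m n y
  ... | shared  | _       = ⊥-elim (x≢0 refl)
  ... | left _  | shared  = ⊥-elim (y≢0 refl)
  ... | right _ | shared  = ⊥-elim (y≢0 refl)
  ... | left a  | left b  = refl
  ... | right a | right b = refl
  ... | left a  | right b with () ← trans (sym (adj-left-right a b)) e
  ... | right a | left b  with () ← trans (sym (adj-right-left a b)) e

  TwoConnected-one-sided : ∀ {k} {ι : Fin k → Fin (suc (m + n))} → Injective _≡_ _≡_ ι →
    TwoConnected (induce S ι) → ∀ {x y} → ι x ≢ zero → ι y ≢ zero → isLeft (ι x) ≡ isLeft (ι y)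
  TwoConnected-one-sided {suc _} {ι} inj p@(_ , connected , _) {x} {y} ιx≢0 ιy≢0
    with any? (λ z → ι z ≟ zero)
  ... | yes (z , ιz≡0) =
    TwoConnected-constant-off p (isLeft ∘ ι) z
      (λ z≢x′ z≢y′ → isLeft-edge (off z≢x′) (off z≢y′)) (on ιx≢0) (on ιy≢0)
    where
    off : ∀ {w} → z ≢ w → ι w ≢ zero
    off z≢w ιw≡0 = z≢w (inj (trans ιz≡0 (sym ιw≡0)))
    on : ∀ {w} → ι w ≢ zero → z ≢ w
    on ιw≢0 refl = ιw≢0 ιz≡0
  ... | no ∄z = Reach-preserves (isLeft ∘ ι) (isLeft-edge (off _) (off _)) (connected x y)
    where
    off : ∀ w → ι w ≢ zero
    off w ιw≡0 = ∄z (w , ιw≡0)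

  embed-left : Fin (suc m) → Fin (suc (m + n))
  embed-left a with a ≟ u
  ... | yes _   = zero
  ... | no a≢u = suc (punchOut (a≢u ∘ sym) ↑ˡ n)

  embed-right : Fin (suc n) → Fin (suc (m + n))
  embed-right b with b ≟ v
  ... | yes _   = zero
  ... | no b≢v = suc (m ↑ʳ punchOut (b≢v ∘ sym))

  left-map : AdjMap G S
  left-map = record { map = embed-left ; preserves = preserves′ }
    where
    preserves′ : ∀ a b → Adj S (embed-left a) (embed-left b) ≡ Adj G a b
    preserves′ a b with a ≟ u | b ≟ u
    ... | yes refl | yes refl = trans (irrefl S zero) (sym (irrefl G a))
    ... | yes refl | no _     = trans (adj-shared-left _) (cong (Adj G u) (punchIn-punchOut _))
    ... | no _     | yes refl = trans (adj-left-shared _) (cong (λ t → Adj G t u) (punchIn-punchOut _))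
    ... | no _     | no _     = trans (adj-left-left _ _)
                                      (cong₂ (Adj G) (punchIn-punchOut _) (punchIn-punchOut _))

  right-map : AdjMap H S
  right-map = record { map = embed-right ; preserves = preserves′ }
    where
    preserves′ : ∀ a b → Adj S (embed-right a) (embed-right b) ≡ Adj H a b
    preserves′ a b with a ≟ v | b ≟ v
    ... | yes refl | yes refl = trans (irrefl S zero) (sym (irrefl H a))
    ... | yes refl | no _     = trans (adj-shared-right _) (cong (Adj H v) (punchIn-punchOut _))
    ... | no _     | yes refl = trans (adj-right-shared _) (cong (λ t → Adj H t v) (punchIn-punchOut _))
    ... | no _     | no _     = trans (adj-right-right _ _)
                                      (cong₂ (Adj H) (punchIn-punchOut _) (punchIn-punchOut _))

  embed-left-u : embed-left u ≡ zero
  embed-left-u with u ≟ u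
  ... | yes _   = refl
  ... | no u≢u = ⊥-elim (u≢u refl)

  embed-left-punchIn : ∀ a → embed-left (punchIn u a) ≡ suc (a ↑ˡ n)
  embed-left-punchIn a with punchIn u a ≟ u
  ... | yes e = ⊥-elim (punchInᵢ≢i u a e)
  ... | no _  = cong (λ t → suc (t ↑ˡ n)) (trans (punchOut-cong u refl) (punchOut-punchIn u))

  embed-right-v : embed-right v ≡ zero
  embed-right-v with v ≟ v
  ... | yes _   = refl
  ... | no v≢v = ⊥-elim (v≢v refl)

  embed-right-punchIn : ∀ b → embed-right (punchIn v b) ≡ suc (m ↑ʳ b)
  embed-right-punchIn b with punchIn v b ≟ v
  ... | yes e = ⊥-elim (punchInᵢ≢i v b e)
  ... | no _  = cong (λ t → suc (m ↑ʳ t)) (trans (punchOut-cong v refl) (punchOut-punchIn v))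

  left-preimage : ∀ w → isRight w ≡ false → ∃ λ a → w ≡ embed-left a
  left-preimage w p with sum1-view m n w
  ... | shared = u , sym embed-left-u
  ... | left a = punchIn u a , sym (embed-left-punchIn a)

  right-preimage : ∀ w → isLeft w ≡ false → ∃ λ b → w ≡ embed-right b
  right-preimage w p with sum1-view m n w
  ... | shared  = v , sym embed-right-v
  ... | right b = punchIn v b , sym (embed-right-punchIn b)

  TwoCograph-sum1 : TwoCograph G → TwoCograph H → TwoCograph S
  TwoCograph-sum1 tG tH k ι inj obs with any? (λ y → isRight (ι y) Bool.≟ true)
  ... | no ∄right = ¬Obstruction-within left-map tG ι inj
                      (λ x → left-preimage (ι x) (Bool.¬-not λ right-x → ∄right (x , right-x))) obs
  ... | yes (y , right-y) = ¬Obstruction-within right-map tH ι inj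
                      (λ x → right-preimage (ι x) (Bool.¬-not (not-left x))) obs
    where
    same-side : ∀ x → isLeft (ι x) ≡ true → isLeft (ι x) ≡ isLeft (ι y)
    same-side x left-x = TwoConnected-one-sided inj (proj₁ obs)
                           (isLeft⇒≢shared (ι x) left-x) (isRight⇒≢shared (ι y) right-y)
    not-left : ∀ x → isLeft (ι x) ≢ true
    not-left x left-x
      with () ← trans (sym left-x) (trans (same-side x left-x) (isRight⇒¬isLeft (ι y) right-y))

TwoCograph-join0 : ∀ {m n} {G : Graph m} {H : Graph n} →
                   TwoCograph G → TwoCograph H → TwoCograph (join0 G H)
TwoCograph-join0 {G = G} {H} tG tH =
  TwoCograph-compl (Sum0.TwoCograph-sum0 (compl G) (compl H) (TwoCograph-compl tG) (TwoCograph-compl tH))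

TwoCograph-join1 : ∀ {m n} {G : Graph (suc m)} {H : Graph (suc n)} (u : Fin (suc m)) (v : Fin (suc n)) →
                   TwoCograph G → TwoCograph H → TwoCograph (join1 G H u v)
TwoCograph-join1 {G = G} {H} u v tG tH =
  TwoCograph-compl (Sum1.TwoCograph-sum1 (compl G) (compl H) u v (TwoCograph-compl tG) (TwoCograph-compl tH))

InC⇒TwoCograph : ∀ {n} {G : Graph n} → InC G → TwoCograph G
InC⇒TwoCograph k1                      = TwoCograph-small K1 (s≤s z≤n)
InC⇒TwoCograph (iso c I)               = TwoCograph-iso I (InC⇒TwoCograph c)
InC⇒TwoCograph (s0 {G = G} {H} c d)    = Sum0.TwoCograph-sum0 G H (InC⇒TwoCograph c) (InC⇒TwoCograph d)
InC⇒TwoCograph (s1 {G = G} {H} c d u v) = Sum1.TwoCograph-sum1 G H u v (InC⇒TwoCograph c) (InC⇒TwoCograph d)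
InC⇒TwoCograph (j0 c d)                = TwoCograph-join0 (InC⇒TwoCograph c) (InC⇒TwoCograph d)
InC⇒TwoCograph (j1 c d u v)            = TwoCograph-join1 u v (InC⇒TwoCograph c) (InC⇒TwoCograph d)

record Partition {N} (P : Fin N → Set) : Set where
  field
    #in #out : ℕ
    to       : Fin #in ⊎ Fin #out → Fin N
    from     : Fin N → Fin #in ⊎ Fin #out
    to∘from  : ∀ k → to (from k) ≡ k
    from∘to  : ∀ s → from (to s) ≡ s
    to-in    : ∀ a → P (to (inj₁ a))
    to-out   : ∀ b → ¬ P (to (inj₂ b))

  to-injective : Injective _≡_ _≡_ to
  to-injective {s} {t} e = trans (sym (from∘to s)) (trans (cong from e) (from∘to t))

  to-inj₁-injective : Injective _≡_ _≡_ (to ∘ inj₁)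
  to-inj₁-injective e = inj₁-injective (to-injective e)

  to-inj₂-injective : Injective _≡_ _≡_ (to ∘ inj₂)
  to-inj₂-injective e = inj₂-injective (to-injective e)

  in-witness : ∀ {k} → P k → Fin #in
  in-witness {k} p with from k in e
  ... | inj₁ a = a
  ... | inj₂ b = ⊥-elim (to-out b (subst P (trans (sym (to∘from k)) (cong to e)) p))

  out-witness : ∀ {k} → ¬ P k → Fin #out
  out-witness {k} ¬p with from k in e
  ... | inj₂ b = b
  ... | inj₁ a = ⊥-elim (¬p (subst P (trans (sym (cong to e)) (to∘from k)) (to-in a)))

  toFin : Fin (#in + #out) → Fin N
  toFin = to ∘ splitAt #in

  fromFin : Fin N → Fin (#in + #out)
  fromFin = join #in #out ∘ from

  fromFin∘toFin : ∀ w → fromFin (toFin w) ≡ w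
  fromFin∘toFin w = trans (cong (join #in #out) (from∘to _)) (join-splitAt #in #out w)

  toFin∘fromFin : ∀ k → toFin (fromFin k) ≡ k
  toFin∘fromFin k = trans (cong to (splitAt-join #in #out (from k))) (to∘from k)

  toFin-↑ˡ : ∀ a → toFin (a ↑ˡ #out) ≡ to (inj₁ a)
  toFin-↑ˡ a = cong to (splitAt-↑ˡ #in a #out)

  toFin-↑ʳ : ∀ b → toFin (#in ↑ʳ b) ≡ to (inj₂ b)
  toFin-↑ʳ b = cong to (splitAt-↑ʳ #in #out b)

partition-[] : (P : Fin 0 → Set) → Partition P
partition-[] P = record
  { #in = 0 ; #out = 0 ; to = λ { (inj₁ ()) ; (inj₂ ()) } ; from = λ ()
  ; to∘from = λ () ; from∘to = λ { (inj₁ ()) ; (inj₂ ()) } ; to-in = λ () ; to-out = λ () }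

partition-∷-in : ∀ {N} {P : Fin (suc N) → Set} → P zero → Partition (P ∘ suc) → Partition P
partition-∷-in {N} {P} p0 π = record
  { #in = suc #in ; #out = #out ; to = to′ ; from = from′
  ; to∘from = to∘from′ ; from∘to = from∘to′ ; to-in = to-in′ ; to-out = to-out }
  where
  open Partition π
  to′ : Fin (suc #in) ⊎ Fin #out → Fin (suc N)
  to′ (inj₁ zero)    = zero
  to′ (inj₁ (suc a)) = suc (to (inj₁ a))
  to′ (inj₂ b)       = suc (to (inj₂ b))
  from′ : Fin (suc N) → Fin (suc #in) ⊎ Fin #out
  from′ zero    = inj₁ zero
  from′ (suc k) = Sum.map₁ suc (from k)
  to′-map₁ : ∀ s → to′ (Sum.map₁ suc s) ≡ suc (to s)
  to′-map₁ (inj₁ a) = refl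
  to′-map₁ (inj₂ b) = refl
  to∘from′ : ∀ k → to′ (from′ k) ≡ k
  to∘from′ zero    = refl
  to∘from′ (suc k) = trans (to′-map₁ (from k)) (cong suc (to∘from k))
  from∘to′ : ∀ s → from′ (to′ s) ≡ s
  from∘to′ (inj₁ zero)    = refl
  from∘to′ (inj₁ (suc a)) = cong (Sum.map₁ suc) (from∘to (inj₁ a))
  from∘to′ (inj₂ b)       = cong (Sum.map₁ suc) (from∘to (inj₂ b))
  to-in′ : ∀ a → P (to′ (inj₁ a))
  to-in′ zero    = p0
  to-in′ (suc a) = to-in a

partition-∷-out : ∀ {N} {P : Fin (suc N) → Set} → ¬ P zero → Partition (P ∘ suc) → Partition P
partition-∷-out {N} {P} ¬p0 π = record
  { #in = #in ; #out = suc #out ; to = to′ ; from = from′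
  ; to∘from = to∘from′ ; from∘to = from∘to′ ; to-in = to-in ; to-out = to-out′ }
  where
  open Partition π
  to′ : Fin #in ⊎ Fin (suc #out) → Fin (suc N)
  to′ (inj₁ a)       = suc (to (inj₁ a))
  to′ (inj₂ zero)    = zero
  to′ (inj₂ (suc b)) = suc (to (inj₂ b))
  from′ : Fin (suc N) → Fin #in ⊎ Fin (suc #out)
  from′ zero    = inj₂ zero
  from′ (suc k) = Sum.map₂ suc (from k)
  to′-map₂ : ∀ s → to′ (Sum.map₂ suc s) ≡ suc (to s)
  to′-map₂ (inj₁ a) = refl
  to′-map₂ (inj₂ b) = refl
  to∘from′ : ∀ k → to′ (from′ k) ≡ k
  to∘from′ zero    = refl
  to∘from′ (suc k) = trans (to′-map₂ (from k)) (cong suc (to∘from k))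
  from∘to′ : ∀ s → from′ (to′ s) ≡ s
  from∘to′ (inj₁ a)       = cong (Sum.map₂ suc) (from∘to (inj₁ a))
  from∘to′ (inj₂ zero)    = refl
  from∘to′ (inj₂ (suc b)) = cong (Sum.map₂ suc) (from∘to (inj₂ b))
  to-out′ : ∀ b → ¬ P (to′ (inj₂ b))
  to-out′ zero    = ¬p0
  to-out′ (suc b) = to-out b

partition : ∀ {N} {P : Fin N → Set} → Decidable P → Partition P
partition {zero}  {P} P? = partition-[] P
partition {suc N} P? with P? zero
... | yes p0  = partition-∷-in p0 (partition (P? ∘ suc))
... | no ¬p0 = partition-∷-out ¬p0 (partition (P? ∘ suc))

punchIn-cons : ∀ {m k} → Fin (suc k) → (Fin m → Fin k) → Fin (suc m) → Fin (suc k)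
punchIn-cons v f zero    = v
punchIn-cons v f (suc a) = punchIn v (f a)

punchOut-cons : ∀ {m k} → Fin (suc k) → (Fin k → Fin m) → Fin (suc k) → Fin (suc m)
punchOut-cons v g x with x ≟ v
... | yes _   = zero
... | no x≢v = suc (g (punchOut (x≢v ∘ sym)))

punchIn-cons-injective : ∀ {m k} (v : Fin (suc k)) {f : Fin m → Fin k} →
                         Injective _≡_ _≡_ f → Injective _≡_ _≡_ (punchIn-cons v f)
punchIn-cons-injective v inj {zero}  {zero}  e = refl
punchIn-cons-injective v inj {zero}  {suc b} e = ⊥-elim (punchInᵢ≢i v _ (sym e))
punchIn-cons-injective v inj {suc a} {zero}  e = ⊥-elim (punchInᵢ≢i v _ e)
punchIn-cons-injective v inj {suc a} {suc b} e = cong suc (inj (punchIn-injective v _ _ e))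

punchOut-cons-punchIn-cons : ∀ {m k} (v : Fin (suc k)) {f : Fin m → Fin k} {g : Fin k → Fin m} →
  (∀ a → g (f a) ≡ a) → ∀ a → punchOut-cons v g (punchIn-cons v f a) ≡ a
punchOut-cons-punchIn-cons v g∘f zero with v ≟ v
... | yes _   = refl
... | no v≢v = ⊥-elim (v≢v refl)
punchOut-cons-punchIn-cons v {f} {g} g∘f (suc a) with punchIn v (f a) ≟ v
... | yes e = ⊥-elim (punchInᵢ≢i v (f a) e)
... | no _  = cong suc (trans (cong g (trans (punchOut-cong v refl) (punchOut-punchIn v))) (g∘f a))

punchIn-cons-punchOut-cons : ∀ {m k} (v : Fin (suc k)) {f : Fin m → Fin k} {g : Fin k → Fin m} →
  (∀ x → f (g x) ≡ x) → ∀ x → punchIn-cons v f (punchOut-cons v g x) ≡ x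
punchIn-cons-punchOut-cons v {f} f∘g x with x ≟ v
... | yes x≡v = sym x≡v
... | no x≢v  = trans (cong (punchIn v) (f∘g _)) (punchIn-punchOut (x≢v ∘ sym))

module _ {N} {P : Fin N → Set} (π : Partition P) (X : Graph N) (separated : Separates X P) where
  open Partition π

  sum0-partition : ∀ {A B} → A ≈ induce X (to ∘ inj₁) → B ≈ induce X (to ∘ inj₂) → Iso (sum0 A B) X
  sum0-partition {A} {B} eA eB = record
    { to = toFin ; from = fromFin ; from∘to = fromFin∘toFin ; to∘from = toFin∘fromFin ; adj = adj′ }
    where
    open Sum0 A B
    adj′ : ∀ w w′ → Adj X (toFin w) (toFin w′) ≡ Adj (sum0 A B) w w′
    adj′ w w′ with sum0-view #in #out w | sum0-view #in #out w′
    ... | left a  | left b  = trans (cong₂ (Adj X) (toFin-↑ˡ a) (toFin-↑ˡ b))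
                                    (sym (trans (adj-left-left a b) (adj-≡ eA a b)))
    ... | right a | right b = trans (cong₂ (Adj X) (toFin-↑ʳ a) (toFin-↑ʳ b))
                                    (sym (trans (adj-right-right a b) (adj-≡ eB a b)))
    ... | left a  | right b = trans (cong₂ (Adj X) (toFin-↑ˡ a) (toFin-↑ʳ b))
                                    (trans (separated (to-in a) (to-out b)) (sym (adj-left-right a b)))
    ... | right a | left b  = trans (cong₂ (Adj X) (toFin-↑ʳ a) (toFin-↑ˡ b))
                                    (trans (symm X _ _)
                                      (trans (separated (to-in b) (to-out a)) (sym (adj-right-left a b))))

module _ {k} {P : Fin k → Set} (π : Partition P) (X : Graph (suc k)) (v : Fin (suc k))
         (separated : Separates (delete X v) P) where
  open Partition π

  sum1-partition : ∀ {A B} → A ≈ induce X (punchIn-cons v (to ∘ inj₁)) →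
                   B ≈ induce X (punchIn-cons v (to ∘ inj₂)) → Iso (sum1 A B zero zero) X
  sum1-partition {A} {B} eA eB = record
    { to = punchIn-cons v toFin ; from = punchOut-cons v fromFin
    ; from∘to = punchOut-cons-punchIn-cons v fromFin∘toFin
    ; to∘from = punchIn-cons-punchOut-cons v toFin∘fromFin
    ; adj = adj′ }
    where
    open Sum1 A B zero zero
    to′-left : ∀ a → punchIn-cons v toFin (suc (a ↑ˡ #out)) ≡ punchIn v (to (inj₁ a))
    to′-left a = cong (punchIn v) (toFin-↑ˡ a)
    to′-right : ∀ b → punchIn-cons v toFin (suc (#in ↑ʳ b)) ≡ punchIn v (to (inj₂ b))
    to′-right b = cong (punchIn v) (toFin-↑ʳ b)
    adj′ : ∀ w w′ →
           Adj X (punchIn-cons v toFin w) (punchIn-cons v toFin w′) ≡ Adj (sum1 A B zero zero) w w′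
    adj′ w w′ with sum1-view #in #out w | sum1-view #in #out w′
    ... | shared  | shared  = trans (irrefl X v) (sym (irrefl (sum1 A B zero zero) zero))
    ... | shared  | left b  = trans (cong (Adj X v) (to′-left b))
                                    (sym (trans (adj-shared-left b) (adj-≡ eA _ _)))
    ... | shared  | right b = trans (cong (Adj X v) (to′-right b))
                                    (sym (trans (adj-shared-right b) (adj-≡ eB _ _)))
    ... | left a  | shared  = trans (cong (λ t → Adj X t v) (to′-left a))
                                    (sym (trans (adj-left-shared a) (adj-≡ eA _ _)))
    ... | right a | shared  = trans (cong (λ t → Adj X t v) (to′-right a))
                                    (sym (trans (adj-right-shared a) (adj-≡ eB _ _)))
    ... | left a  | left b  = trans (cong₂ (Adj X) (to′-left a) (to′-left b))
                                    (sym (trans (adj-left-left a b) (adj-≡ eA _ _)))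
    ... | right a | right b = trans (cong₂ (Adj X) (to′-right a) (to′-right b))
                                    (sym (trans (adj-right-right a b) (adj-≡ eB _ _)))
    ... | left a  | right b = trans (cong₂ (Adj X) (to′-left a) (to′-right b))
                                    (trans (separated (to-in a) (to-out b)) (sym (adj-left-right a b)))
    ... | right a | left b  = trans (cong₂ (Adj X) (to′-right a) (to′-left b))
                                    (trans (symm X _ _)
                                      (trans (separated (to-in b) (to-out a)) (sym (adj-right-left a b))))

-- Decomposing a 2-cograph

positive : ∀ {n} → Fin n → 0 < n
positive x = >-nonZero⁻¹ _ {{nonZeroIndex x}}

record Sum0Split {N} (X : Graph N) : Set where
  field
    m n          : ℕ
    ι₁           : Fin m → Fin N
    ι₂           : Fin n → Fin N
    ι₁-injective : Injective _≡_ _≡_ ι₁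
    ι₂-injective : Injective _≡_ _≡_ ι₂
    x₁           : Fin m
    x₂           : Fin n
    sum0≅        : ∀ {A B} → A ≈ induce X ι₁ → B ≈ induce X ι₂ → Iso (sum0 A B) X

  m<N : m < N
  m<N = subst (m <_) (Iso⇒≡ (sum0≅ ≈-refl ≈-refl)) (m<m+n m (positive x₂))

  n<N : n < N
  n<N = subst (n <_) (Iso⇒≡ (sum0≅ ≈-refl ≈-refl)) (m<n+m n (positive x₁))

record Sum1Split {N} (X : Graph N) : Set where
  field
    m n          : ℕ
    ι₁           : Fin (suc m) → Fin N
    ι₂           : Fin (suc n) → Fin N
    ι₁-injective : Injective _≡_ _≡_ ι₁
    ι₂-injective : Injective _≡_ _≡_ ι₂
    x₁           : Fin m
    x₂           : Fin n
    sum1≅        : ∀ {A B} → A ≈ induce X ι₁ → B ≈ induce X ι₂ → Iso (sum1 A B zero zero) X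

  1+m<N : suc m < N
  1+m<N = subst (suc m <_) (Iso⇒≡ (sum1≅ ≈-refl ≈-refl)) (s≤s (m<m+n m (positive x₂)))

  1+n<N : suc n < N
  1+n<N = subst (suc n <_) (Iso⇒≡ (sum1≅ ≈-refl ≈-refl)) (s≤s (m<n+m n (positive x₁)))

disconnected⇒Sum0Split : ∀ {N} (X : Graph N) → ¬ Connected X → Sum0Split X
disconnected⇒Sum0Split X ¬connected with ¬Connected⇒unreachable X ¬connected
... | i , j , ¬i⇝j = record
  { m = #in ; n = #out ; ι₁ = to ∘ inj₁ ; ι₂ = to ∘ inj₂
  ; ι₁-injective = to-inj₁-injective ; ι₂-injective = to-inj₂-injective
  ; x₁ = in-witness here ; x₂ = out-witness ¬i⇝j
  ; sum0≅ = sum0-partition π X (Reach-separates X i) }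
  where
  π = partition (Reach? X i)
  open Partition π

has-cut-vertex⇒Sum1Split : ∀ {k} (X : Graph (suc k)) → ¬ (∀ v → Connected (delete X v)) → Sum1Split X
has-cut-vertex⇒Sum1Split X ¬no-cut-vertex
  with ¬∀⟶∃¬ _ _ (λ v → Connected? (delete X v)) ¬no-cut-vertex
... | v , ¬connected with ¬Connected⇒unreachable (delete X v) ¬connected
...   | i , j , ¬i⇝j = record
  { m = #in ; n = #out ; ι₁ = punchIn-cons v (to ∘ inj₁) ; ι₂ = punchIn-cons v (to ∘ inj₂)
  ; ι₁-injective = punchIn-cons-injective v to-inj₁-injective
  ; ι₂-injective = punchIn-cons-injective v to-inj₂-injective
  ; x₁ = in-witness here ; x₂ = out-witness ¬i⇝j
  ; sum1≅ = sum1-partition π X v (Reach-separates (delete X v) i) }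
  where
  π = partition (Reach? (delete X v) i)
  open Partition π

SmallerInducedInC : ∀ {N} → Graph N → Set
SmallerInducedInC {N} X =
  ∀ {k} {ι : Fin k → Fin N} → Injective _≡_ _≡_ ι → 0 < k → k < N → InC (induce X ι)

module _ {N} {X : Graph N} (ih : SmallerInducedInC X) where

  InC-sum0 : Sum0Split X → InC X
  InC-sum0 d = iso (s0 (ih ι₁-injective (positive x₁) m<N) (ih ι₂-injective (positive x₂) n<N))
                   (sum0≅ ≈-refl ≈-refl)
    where open Sum0Split d

  InC-join0 : Sum0Split (compl X) → InC X
  InC-join0 d = iso (j0 (ih ι₁-injective (positive x₁) m<N) (ih ι₂-injective (positive x₂) n<N))
                    (Iso-transpose-compl (sum0≅ (compl-induce X ι₁-injective) (compl-induce X ι₂-injective)))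
    where open Sum0Split d

  InC-sum1 : Sum1Split X → InC X
  InC-sum1 d = iso (s1 (ih ι₁-injective (s≤s z≤n) 1+m<N) (ih ι₂-injective (s≤s z≤n) 1+n<N) zero zero)
                   (sum1≅ ≈-refl ≈-refl)
    where open Sum1Split d

  InC-join1 : Sum1Split (compl X) → InC X
  InC-join1 d = iso (j1 (ih ι₁-injective (s≤s z≤n) 1+m<N) (ih ι₂-injective (s≤s z≤n) 1+n<N) zero zero)
                    (Iso-transpose-compl (sum1≅ (compl-induce X ι₁-injective) (compl-induce X ι₂-injective)))
    where open Sum1Split d

K1-iso : (G : Graph 1) → Iso K1 G
K1-iso G = record
  { to = id ; from = id ; from∘to = λ _ → refl ; to∘from = λ _ → refl ; adj = adj }
  where
  adj : ∀ i j → Adj G i j ≡ false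
  adj zero zero = irrefl G zero

Reach⇒Adj-2 : (G : Graph 2) → Reach G zero (suc zero) → Adj G zero (suc zero) ≡ true
Reach⇒Adj-2 G (step {j = zero} e _) with () ← trans (sym e) (irrefl G zero)
Reach⇒Adj-2 G (step {j = suc zero} e _) = e

¬Connected-both-2 : (G : Graph 2) → Connected G → ¬ Connected (compl G)
¬Connected-both-2 G c c′
  with Adj G zero (suc zero) | Reach⇒Adj-2 G (c zero (suc zero))
     | Reach⇒Adj-2 (compl G) (c′ zero (suc zero))
... | true | _ | ()

InC-step-connected : ∀ {n} (X : Graph (3 + n)) → TwoCograph X → SmallerInducedInC X →
                     Connected X → Connected (compl X) → InC X
InC-step-connected X tc ih c c′
  with all? (λ v → Connected? (delete X v)) | all? (λ v → Connected? (delete (compl X) v))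
... | no ¬d | _      = InC-sum1 ih (has-cut-vertex⇒Sum1Split X ¬d)
... | yes _ | no ¬d′ = InC-join1 ih (has-cut-vertex⇒Sum1Split (compl X) ¬d′)
... | yes d | yes d′ = ⊥-elim (tc _ id id ((m≤m+n 3 _ , c , d) , (m≤m+n 3 _ , c′ , d′)))

InC-step : ∀ {N} (X : Graph N) → 0 < N → TwoCograph X → SmallerInducedInC X → InC X
InC-step {1} X _ _ _ = iso k1 (K1-iso X)
InC-step {suc (suc _)} X _ tc ih with Connected? X | Connected? (compl X)
... | no ¬c | _      = InC-sum0 ih (disconnected⇒Sum0Split X ¬c)
... | yes _ | no ¬c′ = InC-join0 ih (disconnected⇒Sum0Split (compl X) ¬c′)
InC-step {2}                 X _ tc ih | yes c | yes c′ = ⊥-elim (¬Connected-both-2 X c c′)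
InC-step {suc (suc (suc _))} X _ tc ih | yes c | yes c′ = InC-step-connected X tc ih c c′

TwoCograph⇒InC : ∀ {N} (X : Graph N) → 0 < N → TwoCograph X → InC X
TwoCograph⇒InC {N} = <-rec (λ N → (X : Graph N) → 0 < N → TwoCograph X → InC X) induction-step N
  where
  induction-step : ∀ N → (∀ {k} → k < N → (Y : Graph k) → 0 < k → TwoCograph Y → InC Y) →
                   (X : Graph N) → 0 < N → TwoCograph X → InC X
  induction-step N rec X pos tc =
    InC-step X pos tc λ inj k>0 k<N → rec k<N _ k>0 (TwoCograph-induce X inj tc)

lemma2p8 : ∀ (n : ℕ) (G : Graph (suc n)) → (InC G → TwoCograph G) × (TwoCograph G → InC G)
lemma2p8 n G = InC⇒TwoCograph , TwoCograph⇒InC G (s≤s z≤n)
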